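{- For any consistent LE-$\mathcal{ALC}$ ABox $\mathcal{A}$, any individual names $b$ (object) and $y$ (feature) appearing in its tableaux completion $\overline{\mathcal{A}}$, and any concepts $C, C_1, C_2$ appearing in $\mathcal{A}$: 1. $\mathcal{A} \models con(b) \sqsubseteq con(y)$ iff $b I y \in \overline{\mathcal{A}}$; 2. $\mathcal{A} \models con(b) \sqsubseteq \Box con(y)$ iff $b R_\Box y \in \overline{\mathcal{A}}$; 3. $\mathcal{A} \models \Diamond con(b) \sqsubseteq con(y)$ iff $y R_\Diamond b \in \overline{\mathcal{A}}$; 4. $\mathcal{A} \models con(b) \sqsubseteq C$ iff $b I x_C \in \overline{\mathcal{A}}$; 5. $\mathcal{A} \models C \sqsubseteq con(y)$ iff $a_C I y \in \overline{\mathcal{A}}$; 6. $\mathcal{A} \models con(b) \sqsubseteq C$ iff $b:C \in \overline{\mathcal{A}}$; 7. $\mathcal{A} \models C \sqsubseteq con(y)$ iff $y::C \in \overline{\mathcal{A}}$; 8. $\mathcal{A} \models C_1 \sqsubseteq C_2$ iff $a_{C_1} I x_{C_2} \in \overline{\mathcal{A}}$.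
   Context: LE-$\mathcal{ALC}$ is a two-sorted description logic interpreted over enriched formal contexts $\mathbb{F}=(A,X,I,R_\Box,R_\Diamond)$ with $I,R_\Box\subseteq A\times X$, $R_\Diamond\subseteq X\times A$ ($I$-compatible). Concepts: $C ::= D \mid C_1\wedge C_2 \mid C_1\vee C_2 \mid \langle R_\Diamond\rangle C \mid [R_\Box]C$ (written $\Diamond C$, $\Box C$), interpreted as formal concepts of the concept lattice. ABox terms: $aR_\Box x$, $xR_\Diamond a$, $aIx$, $a:C$ ($a$ in the extension of $C$), $x::C$ ($x$ in the intension of $C$), and negations $\neg\alpha$ of these. $\overline{\mathcal{A}}$ is the (non-branching) tableaux completion of $\mathcal{A}$ under the LE-$\mathcal{ALC}$ expansion rules: creation (for each $C\in\mathcal{A}$ add $a_C:C$, $x_C::C$ with new classifying object $a_C$ and feature $x_C$); basic ($b:C$, $y::C$ give $bIy$); $\wedge_A$, $\vee_X$ and their inverses (inverse only for meets/joins occurring in $\mathcal{A}$); $\Box$ ($b:[R_\Box]C$, $y::C$ give $bR_\Box y$); $\Diamond$ ($y::\langle R_\Diamond\rangle C$, $b:C$ give $yR_\Diamond b$); adjunction ($bR_\Box y$ gives $\mathrm{L}_\Box b\, I\, y$ and $b I \Box y$; $yR_\Diamond b$ gives $\Diamond b I y$ and $b I \blacksquare y$, with new individual names except $\Diamond a_C = a_{\Diamond C}$, $\Box x_C = x_{\Box C}$); $I$-compatibility (each of $bI\Box y$, $\mathrm{L}_\Box b\,I\,y$ gives $bR_\Box y$; each of $bI\blacksquare y$, $\Diamond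 b I y$ gives $yR_\Diamond b$); negative ($\neg(b:C)$ gives $\neg(bIx_C)$; $\neg(y::C)$ gives $\neg(a_C I y)$); appending ($bIx_C$ gives $b:C$; $a_C I y$ gives $y::C$). Here $\mathrm{L}_\Box$ denotes the operation left adjoint to $\Box$ (written as a black lozenge in the paper) and $\blacksquare$ the right adjoint of $\Diamond$. Concept companions: for a constant $b$ (resp. $y$) of $\mathcal{A}$, $con(b)$ (resp. $con(y)$) is interpreted in every interpretation as the concept generated by $b$, i.e. $(b^{\uparrow\downarrow},b^{\uparrow})$ (resp. by $y$, $(y^{\downarrow},y^{\downarrow\uparrow})$); and $con(\Diamond b)=\Diamond con(b)$, $con(\mathrm{L}_\Box b)=\mathrm{L}_\Box con(b)$, $con(\blacksquare y)=\blacksquare con(y)$, $con(\Box y)=\Box con(y)$. -}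

module Defs where

open import Data.Nat using (ℕ)
open import Data.List using (List)
open import Data.List.Membership.Propositional using (_∈_)
open import Data.Product using (Σ; _×_; ∃; ∃-syntax; _,_)
open import Relation.Nullary using (¬_)
open import Function.Bundles using (_⇔_)
open import Data.Sum using (_⊎_)

-- Concept names, object constants and feature constants are indexed by ℕ.
data Concept : Set where
  atom : ℕ → Concept
  _⊓_  : Concept → Concept → Concept
  _⊔_  : Concept → Concept → Concept
  ◇_   : Concept → Concept
  □_   : Concept → Concept

data Sub : Concept → Concept → Set where
  here : ∀ {C} → Sub C C
  ⊓l   : ∀ {C D E} → Sub C D → Sub C (D ⊓ E)
  ⊓r   : ∀ {C D E} → Sub C E → Sub C (D ⊓ E)
  ⊔l   : ∀ {C D E} → Sub C D → Sub C (D ⊔ E)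
  ⊔r   : ∀ {C D E} → Sub C E → Sub C (D ⊔ E)
  ◇s   : ∀ {C D} → Sub C D → Sub C (◇ D)
  □s   : ∀ {C D} → Sub C D → Sub C (□ D)

data Atom (O F : Set) : Set where
  rbox : O → F → Atom O F     -- b R□ y
  rdia : F → O → Atom O F     -- y R◇ b
  inc  : O → F → Atom O F     -- b I y
  ext  : O → Concept → Atom O F   -- b : C
  int  : F → Concept → Atom O F   -- y :: C

data Lit (O F : Set) : Set where
  pos : Atom O F → Lit O F
  neg : Atom O F → Lit O F

ABox : Set
ABox = List (Lit ℕ ℕ)

data ConOf {O F : Set} : Concept → Atom O F → Set where
  cext : ∀ {b C} → ConOf C (ext b C)
  cint : ∀ {y C} → ConOf C (int y C)

data ConOfL {O F : Set} (C : Concept) : Lit O F → Set where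
  cpos : ∀ {α} → ConOf C α → ConOfL C (pos α)
  cneg : ∀ {α} → ConOf C α → ConOfL C (neg α)

Occurs : Concept → ABox → Set
Occurs C 𝒜 = ∃[ t ] (t ∈ 𝒜 × ∃[ D ] (ConOfL D t × Sub C D))

data Obj : Set where
  oc   : ℕ → Obj
  aC   : Concept → Obj     -- classifying object a_C
  diaT : Obj → Obj
  lbox : Obj → Obj         -- L□ b  (left adjoint of □)

data Feat : Set where
  fc   : ℕ → Feat
  xC   : Concept → Feat    -- classifying feature x_C
  boxT : Feat → Feat
  bsq  : Feat → Feat       -- ■ y  (right adjoint of ◇)

-- ◇ on object names, with the identification ◇ a_C = a_{◇C}
dia : Obj → Obj
dia (aC C) = aC (◇ C)
dia b      = diaT b

-- □ on feature names, with the identification □ x_C = x_{□C}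
box : Feat → Feat
box (xC C) = xC (□ C)
box y      = boxT y

embA : Atom ℕ ℕ → Atom Obj Feat
embA (rbox a x) = rbox (oc a) (fc x)
embA (rdia x a) = rdia (fc x) (oc a)
embA (inc a x)  = inc (oc a) (fc x)
embA (ext a C)  = ext (oc a) C
embA (int x C)  = int (fc x) C

emb : Lit ℕ ℕ → Lit Obj Feat
emb (pos α) = pos (embA α)
emb (neg α) = neg (embA α)

-- Tableaux completion 𝒜‾ : the least set of terms containing 𝒜 and
-- closed under the LE-ALC expansion rules.

infix 4 _∈‾_
data _∈‾_ : Lit Obj Feat → ABox → Set where
  init    : ∀ {𝒜 t} → t ∈ 𝒜 → emb t ∈‾ 𝒜
  createA : ∀ {𝒜 C} → Occurs C 𝒜 → pos (ext (aC C) C) ∈‾ 𝒜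
  createX : ∀ {𝒜 C} → Occurs C 𝒜 → pos (int (xC C) C) ∈‾ 𝒜
  basic   : ∀ {𝒜 b y C} → pos (ext b C) ∈‾ 𝒜 → pos (int y C) ∈‾ 𝒜 → pos (inc b y) ∈‾ 𝒜
  ⊓A₁     : ∀ {𝒜 b C₁ C₂} → pos (ext b (C₁ ⊓ C₂)) ∈‾ 𝒜 → pos (ext b C₁) ∈‾ 𝒜
  ⊓A₂     : ∀ {𝒜 b C₁ C₂} → pos (ext b (C₁ ⊓ C₂)) ∈‾ 𝒜 → pos (ext b C₂) ∈‾ 𝒜
  ⊓A⁻¹    : ∀ {𝒜 b C₁ C₂} → Occurs (C₁ ⊓ C₂) 𝒜 →
            pos (ext b C₁) ∈‾ 𝒜 → pos (ext b C₂) ∈‾ 𝒜 → pos (ext b (C₁ ⊓ C₂)) ∈‾ 𝒜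
  ⊔X₁     : ∀ {𝒜 y C₁ C₂} → pos (int y (C₁ ⊔ C₂)) ∈‾ 𝒜 → pos (int y C₁) ∈‾ 𝒜
  ⊔X₂     : ∀ {𝒜 y C₁ C₂} → pos (int y (C₁ ⊔ C₂)) ∈‾ 𝒜 → pos (int y C₂) ∈‾ 𝒜
  ⊔X⁻¹    : ∀ {𝒜 y C₁ C₂} → Occurs (C₁ ⊔ C₂) 𝒜 →
            pos (int y C₁) ∈‾ 𝒜 → pos (int y C₂) ∈‾ 𝒜 → pos (int y (C₁ ⊔ C₂)) ∈‾ 𝒜
  □rule   : ∀ {𝒜 b y C} → pos (ext b (□ C)) ∈‾ 𝒜 → pos (int y C) ∈‾ 𝒜 → pos (rbox b y) ∈‾ 𝒜
  ◇rule   : ∀ {𝒜 b y C} → pos (int y (◇ C)) ∈‾ 𝒜 → pos (ext b C) ∈‾ 𝒜 → pos (rdia y b) ∈‾ 𝒜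
  adjR□₁  : ∀ {𝒜 b y} → pos (rbox b y) ∈‾ 𝒜 → pos (inc (lbox b) y) ∈‾ 𝒜
  adjR□₂  : ∀ {𝒜 b y} → pos (rbox b y) ∈‾ 𝒜 → pos (inc b (box y)) ∈‾ 𝒜
  adjR◇₁  : ∀ {𝒜 b y} → pos (rdia y b) ∈‾ 𝒜 → pos (inc (dia b) y) ∈‾ 𝒜
  adjR◇₂  : ∀ {𝒜 b y} → pos (rdia y b) ∈‾ 𝒜 → pos (inc b (bsq y)) ∈‾ 𝒜
  icR□₁   : ∀ {𝒜 b y} → pos (inc b (box y)) ∈‾ 𝒜 → pos (rbox b y) ∈‾ 𝒜
  icR□₂   : ∀ {𝒜 b y} → pos (inc (lbox b) y) ∈‾ 𝒜 → pos (rbox b y) ∈‾ 𝒜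
  icR◇₁   : ∀ {𝒜 b y} → pos (inc b (bsq y)) ∈‾ 𝒜 → pos (rdia y b) ∈‾ 𝒜
  icR◇₂   : ∀ {𝒜 b y} → pos (inc (dia b) y) ∈‾ 𝒜 → pos (rdia y b) ∈‾ 𝒜
  negA    : ∀ {𝒜 b C} → neg (ext b C) ∈‾ 𝒜 → neg (inc b (xC C)) ∈‾ 𝒜
  negX    : ∀ {𝒜 y C} → neg (int y C) ∈‾ 𝒜 → neg (inc (aC C) y) ∈‾ 𝒜
  appA    : ∀ {𝒜 b C} → pos (inc b (xC C)) ∈‾ 𝒜 → pos (ext b C) ∈‾ 𝒜
  appX    : ∀ {𝒜 y C} → pos (inc (aC C) y) ∈‾ 𝒜 → pos (int y C) ∈‾ 𝒜

data ObjIn {F : Set} {O : Set} (b : O) : Atom O F → Set where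
  o-rbox : ∀ {y} → ObjIn b (rbox b y)
  o-rdia : ∀ {y} → ObjIn b (rdia y b)
  o-inc  : ∀ {y} → ObjIn b (inc b y)
  o-ext  : ∀ {C} → ObjIn b (ext b C)

data FeatIn {O : Set} {F : Set} (y : F) : Atom O F → Set where
  f-rbox : ∀ {b} → FeatIn y (rbox b y)
  f-rdia : ∀ {b} → FeatIn y (rdia y b)
  f-inc  : ∀ {b} → FeatIn y (inc b y)
  f-int  : ∀ {C} → FeatIn y (int y C)

ObjAppears : Obj → ABox → Set
ObjAppears b 𝒜 = ∃[ α ] ((pos α ∈‾ 𝒜 ⊎ neg α ∈‾ 𝒜) × ObjIn b α)

FeatAppears : Feat → ABox → Set
FeatAppears y 𝒜 = ∃[ α ] ((pos α ∈‾ 𝒜 ⊎ neg α ∈‾ 𝒜) × FeatIn y α)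

record Model : Set₁ where
  field
    A  : Set
    X  : Set
    I  : A → X → Set
    R□ : A → X → Set
    R◇ : X → A → Set
    -- I-compatibility: R□^{(0)}[x], R□^{(1)}[a], R◇^{(0)}[a], R◇^{(1)}[x] are Galois-stable
    R□⁰-stable : ∀ x a → (∀ y → (∀ a' → R□ a' x → I a' y) → I a y) → R□ a x
    R□¹-stable : ∀ a x → (∀ b → (∀ y → R□ a y → I b y) → I b x) → R□ a x
    R◇⁰-stable : ∀ a x → (∀ b → (∀ y → R◇ y a → I b y) → I b x) → R◇ x a
    R◇¹-stable : ∀ x a → (∀ y → (∀ b → R◇ x b → I b y) → I a y) → R◇ x a
    extD : ℕ → A → Set
    intD : ℕ → X → Set
    extD-closed : ∀ n a → ((∀ x → intD n x → I a x) ⇔ extD n a)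
    intD-closed : ∀ n x → ((∀ a → extD n a → I a x) ⇔ intD n x)
    objC  : ℕ → A
    featC : ℕ → X

module Sem (M : Model) where
  open Model M

  record SC : Set₁ where
    constructor ⟨_,_⟩
    field
      ex : A → Set
      in' : X → Set
  open SC public

  _↑ : (A → Set) → X → Set
  (P ↑) x = ∀ a → P a → I a x

  _↓ : (X → Set) → A → Set
  (Q ↓) a = ∀ x → Q x → I a x

  ◇c : SC → SC
  ◇c c = ⟨ (λ x → ∀ a → ex c a → R◇ x a) ↓ , (λ x → ∀ a → ex c a → R◇ x a) ⟩

  □c : SC → SC
  □c c = ⟨ (λ a → ∀ x → in' c x → R□ a x) , (λ a → ∀ x → in' c x → R□ a x) ↑ ⟩

  -- left adjoint of □
  L□c : SC → SC
  L□c c = ⟨ (λ x → ∀ a → ex c a → R□ a x) ↓ , (λ x → ∀ a → ex c a → R□ a x) ⟩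

  -- right adjoint of ◇
  ■c : SC → SC
  ■c c = ⟨ (λ a → ∀ x → in' c x → R◇ x a) , (λ a → ∀ x → in' c x → R◇ x a) ↑ ⟩

  ⟦_⟧ : Concept → SC
  ⟦ atom n ⟧ = ⟨ extD n , intD n ⟩
  ⟦ C₁ ⊓ C₂ ⟧ = ⟨ (λ a → ex ⟦ C₁ ⟧ a × ex ⟦ C₂ ⟧ a) , (λ a → ex ⟦ C₁ ⟧ a × ex ⟦ C₂ ⟧ a) ↑ ⟩
  ⟦ C₁ ⊔ C₂ ⟧ = ⟨ (λ x → in' ⟦ C₁ ⟧ x × in' ⟦ C₂ ⟧ x) ↓ , (λ x → in' ⟦ C₁ ⟧ x × in' ⟦ C₂ ⟧ x) ⟩
  ⟦ ◇ C ⟧ = ◇c ⟦ C ⟧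
  ⟦ □ C ⟧ = □c ⟦ C ⟧

  conO : Obj → SC
  conO (oc n)    = ⟨ (λ a → ∀ x → I (objC n) x → I a x) , I (objC n) ⟩
  conO (aC C)    = ⟦ C ⟧
  conO (diaT b)  = ◇c (conO b)
  conO (lbox b)  = L□c (conO b)

  conF : Feat → SC
  conF (fc n)    = ⟨ (λ a → I a (featC n)) , (λ x → ∀ a → I a (featC n) → I a x) ⟩
  conF (xC C)    = ⟦ C ⟧
  conF (boxT y)  = □c (conF y)
  conF (bsq y)   = ■c (conF y)

  _⊑_ : SC → SC → Set
  c ⊑ d = ∀ a → ex c a → ex d a

  satA : Atom ℕ ℕ → Set
  satA (rbox a x) = R□ (objC a) (featC x)
  satA (rdia x a) = R◇ (featC x) (objC a)
  satA (inc a x)  = I (objC a) (featC x)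
  satA (ext a C)  = ex ⟦ C ⟧ (objC a)
  satA (int x C)  = in' ⟦ C ⟧ (featC x)

  satL : Lit ℕ ℕ → Set
  satL (pos α) = satA α
  satL (neg α) = ¬ satA α

  Satisfies : ABox → Set
  Satisfies 𝒜 = ∀ t → t ∈ 𝒜 → satL t

open Sem public using (SC; conO; conF; ⟦_⟧; ◇c; □c; Satisfies)

Consistent : ABox → Set₁
Consistent 𝒜 = ∃[ M ] Satisfies M 𝒜

_⊨_⊑_ : ABox → ((M : Model) → SC M) → ((M : Model) → SC M) → Set₁
𝒜 ⊨ c ⊑ d = ∀ (M : Model) → Satisfies M 𝒜 → Sem._⊑_ M (c M) (d M)

{-# OPTIONS --safe #-}
-- Soundness: every expansion rule is an inequality valid in the concept lattice of any
-- enriched formal context; I-compatibility is exactly what makes L□ ⊣ □ and ◇ ⊣ ■ hold there.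
-- Completeness: the individual names of 𝒜‾ form a canonical enriched formal context K whose
-- relations I, R□, R◇ are the derived relational terms. The classifying names a_C and x_C make
-- the interpretation of every concept of 𝒜 in K consist of the derived terms b : C and y :: C,
-- every name of 𝒜‾ lies in its own concept companion, and consistency of 𝒜 makes K a model
-- of 𝒜. An inclusion valid in all models of 𝒜 therefore holds in K, and evaluating it at the
-- names themselves gives the derived term.
module Submission where

open import Defs hiding (SC; conO; conF; ⟦_⟧; ◇c; □c; Satisfies)
open import Data.Empty using (⊥)
open import Data.List.Membership.Propositional using (_∈_)
open import Data.Nat using (ℕ)
open import Data.Product using (_×_; _,_; proj₁; proj₂; map₂; swap)
open import Data.Sum using (inj₁; inj₂)
open import Data.Unit using (⊤; tt)
open import Function using (id)
open import Function.Bundles using (_⇔_; mk⇔; Equivalence)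
open import Function.Properties.Equivalence using () renaming (trans to ⇔-trans)
open import Relation.Binary.PropositionalEquality using (_≡_; refl; sym; subst)

open Equivalence using (to; from)

Sub-trans : ∀ {C D E} → Sub C D → Sub D E → Sub C E
Sub-trans s here   = s
Sub-trans s (⊓l t) = ⊓l (Sub-trans s t)
Sub-trans s (⊓r t) = ⊓r (Sub-trans s t)
Sub-trans s (⊔l t) = ⊔l (Sub-trans s t)
Sub-trans s (⊔r t) = ⊔r (Sub-trans s t)
Sub-trans s (◇s t) = ◇s (Sub-trans s t)
Sub-trans s (□s t) = □s (Sub-trans s t)

Occurs-sub : ∀ {C D 𝒜} → Sub C D → Occurs D 𝒜 → Occurs C 𝒜
Occurs-sub s (t , t∈𝒜 , E , D∈t , D≤E) = t , t∈𝒜 , E , D∈t , Sub-trans s D≤E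

Occurs-member : ∀ {C t 𝒜} → t ∈ 𝒜 → ConOfL C t → Occurs C 𝒜
Occurs-member t∈𝒜 C∈t = _ , t∈𝒜 , _ , C∈t , here

module ConceptLattice (M : Model) where
  open Model M
  open Sem M

  record IsFormalConcept (c : SC) : Set where
    field
      incident   : ∀ {a x} → ex c a → in' c x → I a x
      ex-closed  : ∀ {a} → (in' c ↓) a → ex c a
      in'-closed : ∀ {x} → (ex c ↑) x → in' c x
  open IsFormalConcept public

  stable-intension⇒formal : ∀ {Q} → (∀ {x} → (Q ↓ ↑) x → Q x) → IsFormalConcept ⟨ Q ↓ , Q ⟩
  stable-intension⇒formal stable = record
    { incident = λ e q → e _ q ; ex-closed = id ; in'-closed = stable }

  stable-extension⇒formal : ∀ {P} → (∀ {a} → (P ↑ ↓) a → P a) → IsFormalConcept ⟨ P , P ↑ ⟩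
  stable-extension⇒formal stable = record
    { incident = λ p q → q _ p ; ex-closed = stable ; in'-closed = id }

  ◇c-formal : ∀ c → IsFormalConcept (◇c c)
  ◇c-formal c = stable-intension⇒formal λ {x} h a e →
    R◇⁰-stable a x (λ b hb → h b (λ y q → hb y (q a e)))

  □c-formal : ∀ c → IsFormalConcept (□c c)
  □c-formal c = stable-extension⇒formal λ {a} h x q →
    R□⁰-stable x a (λ y hy → h y (λ b p → hy b (p x q)))

  ■c-formal : ∀ c → IsFormalConcept (■c c)
  ■c-formal c = stable-extension⇒formal λ {a} h x q →
    R◇¹-stable x a (λ y hy → h y (λ b p → hy b (p x q)))

  infixr 6 _∧c_
  infixr 5 _∨c_

  _∧c_ : SC → SC → SC
  c ∧c d = ⟨ (λ a → ex c a × ex d a) , (λ a → ex c a × ex d a) ↑ ⟩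

  _∨c_ : SC → SC → SC
  c ∨c d = ⟨ (λ x → in' c x × in' d x) ↓ , (λ x → in' c x × in' d x) ⟩

  ∧c-formal : ∀ {c d} → IsFormalConcept c → IsFormalConcept d → IsFormalConcept (c ∧c d)
  ∧c-formal C D = stable-extension⇒formal λ h →
      ex-closed C (λ x q → h x (λ a e → incident C (proj₁ e) q))
    , ex-closed D (λ x q → h x (λ a e → incident D (proj₂ e) q))

  ∨c-formal : ∀ {c d} → IsFormalConcept c → IsFormalConcept d → IsFormalConcept (c ∨c d)
  ∨c-formal C D = stable-intension⇒formal λ h →
      in'-closed C (λ a e → h a (λ x q → incident C e (proj₁ q)))
    , in'-closed D (λ a e → h a (λ x q → incident D e (proj₂ q)))

  ⟦_⟧-formal : ∀ C → IsFormalConcept ⟦ C ⟧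
  ⟦ atom n ⟧-formal = record
    { incident   = λ {a} e q → from (extD-closed n a) e _ q
    ; ex-closed  = λ {a} → to (extD-closed n a)
    ; in'-closed = λ {x} → to (intD-closed n x) }
  ⟦ C₁ ⊓ C₂ ⟧-formal = ∧c-formal ⟦ C₁ ⟧-formal ⟦ C₂ ⟧-formal
  ⟦ C₁ ⊔ C₂ ⟧-formal = ∨c-formal ⟦ C₁ ⟧-formal ⟦ C₂ ⟧-formal
  ⟦ ◇ C ⟧-formal     = ◇c-formal ⟦ C ⟧
  ⟦ □ C ⟧-formal     = □c-formal ⟦ C ⟧

  conF-formal : ∀ y → IsFormalConcept (conF y)
  conF-formal (fc n)   = stable-extension⇒formal (λ h → h (featC n) (λ a q → q))
  conF-formal (xC C)   = ⟦ C ⟧-formal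
  conF-formal (boxT y) = □c-formal (conF y)
  conF-formal (bsq y)  = ■c-formal (conF y)

  conO-dia : ∀ b → conO (dia b) ≡ ◇c (conO b)
  conO-dia (oc n)   = refl
  conO-dia (aC C)   = refl
  conO-dia (diaT b) = refl
  conO-dia (lbox b) = refl

  conF-box : ∀ y → conF (box y) ≡ □c (conF y)
  conF-box (fc n)   = refl
  conF-box (xC C)   = refl
  conF-box (boxT y) = refl
  conF-box (bsq y)  = refl

  -- _⊑_ unfolds to a Π-type from which the unifier cannot recover the two concepts;
  -- this wrapper keeps them visible, so that they can be left implicit.
  infix 4 _≤_

  record _≤_ (c d : SC) : Set where
    constructor ⊑⇒≤
    field ≤⇒⊑ : c ⊑ d
  open _≤_ public

  ≤-refl : ∀ {c} → c ≤ c
  ≤-refl = ⊑⇒≤ λ a e → e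

  ≤-trans : ∀ {c d e} → c ≤ d → d ≤ e → c ≤ e
  ≤-trans (⊑⇒≤ c⊑d) (⊑⇒≤ d⊑e) = ⊑⇒≤ λ a p → d⊑e a (c⊑d a p)

  ≤⇒in'-⊇ : ∀ {c d} → IsFormalConcept c → IsFormalConcept d → c ≤ d → ∀ {x} → in' d x → in' c x
  ≤⇒in'-⊇ C D (⊑⇒≤ c⊑d) q = in'-closed C (λ a e → incident D (c⊑d a e) q)

  c∧d≤c : ∀ {c d} → c ∧c d ≤ c
  c∧d≤c = ⊑⇒≤ λ a → proj₁

  c∧d≤d : ∀ {c d} → c ∧c d ≤ d
  c∧d≤d = ⊑⇒≤ λ a → proj₂

  ∧c-greatest : ∀ {c d e} → e ≤ c → e ≤ d → e ≤ c ∧c d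
  ∧c-greatest (⊑⇒≤ e⊑c) (⊑⇒≤ e⊑d) = ⊑⇒≤ λ a p → e⊑c a p , e⊑d a p

  c≤c∨d : ∀ {c d} → IsFormalConcept c → c ≤ c ∨c d
  c≤c∨d C = ⊑⇒≤ λ a e x q → incident C e (proj₁ q)

  d≤c∨d : ∀ {c d} → IsFormalConcept d → d ≤ c ∨c d
  d≤c∨d D = ⊑⇒≤ λ a e x q → incident D e (proj₂ q)

  ∨c-least : ∀ {c d e} → IsFormalConcept c → IsFormalConcept d → IsFormalConcept e →
             c ≤ e → d ≤ e → c ∨c d ≤ e
  ∨c-least C D E c≤e d≤e =
    ⊑⇒≤ λ a p → ex-closed E (λ x q → p x (≤⇒in'-⊇ C E c≤e q , ≤⇒in'-⊇ D E d≤e q))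

  ◇c-mono : ∀ {c d} → c ≤ d → ◇c c ≤ ◇c d
  ◇c-mono (⊑⇒≤ c⊑d) = ⊑⇒≤ λ a e x q → e x (λ b p → q b (c⊑d b p))

  □c-mono : ∀ {c d} → IsFormalConcept c → IsFormalConcept d → c ≤ d → □c c ≤ □c d
  □c-mono C D c≤d = ⊑⇒≤ λ a p x q → p x (≤⇒in'-⊇ C D c≤d q)

  L□c⊣□c : ∀ {c d} → IsFormalConcept d → (L□c c ≤ d) ⇔ (c ≤ □c d)
  L□c⊣□c D = mk⇔
    (λ (⊑⇒≤ h) → ⊑⇒≤ λ a e x q →
      R□¹-stable a x (λ b hb → incident D (h b (λ y r → hb y (r a e))) q))
    (λ (⊑⇒≤ h) → ⊑⇒≤ λ a e → ex-closed D (λ x q → e x (λ b p → h b p x q)))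

  ◇c⊣■c : ∀ {c d} → IsFormalConcept d → (◇c c ≤ d) ⇔ (c ≤ ■c d)
  ◇c⊣■c D = mk⇔
    (λ (⊑⇒≤ h) → ⊑⇒≤ λ a e x q →
      R◇⁰-stable a x (λ b hb → incident D (h b (λ y r → hb y (r a e))) q))
    (λ (⊑⇒≤ h) → ⊑⇒≤ λ a e → ex-closed D (λ x q → e x (λ b p → h b p x q)))

  conO-oc-least : ∀ {c n} → IsFormalConcept c → (conO (oc n) ≤ c) ⇔ ex c (objC n)
  conO-oc-least {n = n} C = mk⇔
    (λ (⊑⇒≤ h) → h (objC n) (λ x q → q))
    (λ e → ⊑⇒≤ λ a h → ex-closed C (λ x q → h x (incident C e q)))

  conF-fc-greatest : ∀ {c n} → IsFormalConcept c → (c ≤ conF (fc n)) ⇔ in' c (featC n)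
  conF-fc-greatest C = mk⇔ (λ (⊑⇒≤ h) → in'-closed C h) (λ q → ⊑⇒≤ λ a e → incident C e q)

  □c-conF-fc : ∀ {a n} → ex (□c (conF (fc n))) a ⇔ R□ a (featC n)
  □c-conF-fc {a} {n} = mk⇔
    (λ p → p (featC n) (λ b q → q))
    (λ r x q → R□¹-stable a x (λ b hb → q b (hb (featC n) r)))

  ◇c-conO-oc : ∀ {x n} → in' (◇c (conO (oc n))) x ⇔ R◇ x (objC n)
  ◇c-conO-oc {x} {n} = mk⇔
    (λ h → h (objC n) (λ y q → q))
    (λ r a e → R◇¹-stable x a (λ y hy → e y (hy (objC n) r)))

  lhs rhs : Atom Obj Feat → SC
  lhs (rbox b y) = conO b
  lhs (rdia y b) = ◇c (conO b)
  lhs (inc b y)  = conO b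
  lhs (ext b C)  = conO b
  lhs (int y C)  = ⟦ C ⟧
  rhs (rbox b y) = □c (conF y)
  rhs (rdia y b) = conF y
  rhs (inc b y)  = conF y
  rhs (ext b C)  = ⟦ C ⟧
  rhs (int y C)  = conF y

  Meaning : Atom Obj Feat → Set
  Meaning α = lhs α ≤ rhs α

  LitMeaning : Lit Obj Feat → Set
  LitMeaning (pos α) = Meaning α
  LitMeaning (neg α) = ⊤

  Meaning-embA⇔satA : ∀ α → Meaning (embA α) ⇔ satA α
  Meaning-embA⇔satA (rbox a x) = ⇔-trans (conO-oc-least (□c-formal (conF (fc x)))) □c-conF-fc
  Meaning-embA⇔satA (rdia x a) = ⇔-trans (conF-fc-greatest (◇c-formal (conO (oc a)))) ◇c-conO-oc
  Meaning-embA⇔satA (inc a x)  = conO-oc-least (conF-formal (fc x))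
  Meaning-embA⇔satA (ext a C)  = conO-oc-least ⟦ C ⟧-formal
  Meaning-embA⇔satA (int x C)  = conF-fc-greatest ⟦ C ⟧-formal

  module _ {𝒜 : ABox} (⊨𝒜 : Satisfies 𝒜) where

    sound : ∀ {t} → t ∈‾ 𝒜 → LitMeaning t
    sound (init {t = pos α} t∈𝒜) = from (Meaning-embA⇔satA α) (⊨𝒜 _ t∈𝒜)
    sound (init {t = neg α} _)   = tt
    sound (createA _)            = ≤-refl
    sound (createX _)            = ≤-refl
    sound (basic p q)            = ≤-trans (sound p) (sound q)
    sound (⊓A₁ {C₂ = C₂} p)      = ≤-trans (sound p) (c∧d≤c {d = ⟦ C₂ ⟧})
    sound (⊓A₂ {C₁ = C₁} p)      = ≤-trans (sound p) (c∧d≤d {c = ⟦ C₁ ⟧})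
    sound (⊓A⁻¹ _ p q)           = ∧c-greatest (sound p) (sound q)
    sound (⊔X₁ {C₁ = C₁} {C₂} p) = ≤-trans (c≤c∨d {d = ⟦ C₂ ⟧} ⟦ C₁ ⟧-formal) (sound p)
    sound (⊔X₂ {C₁ = C₁} {C₂} p) = ≤-trans (d≤c∨d {c = ⟦ C₁ ⟧} ⟦ C₂ ⟧-formal) (sound p)
    sound (⊔X⁻¹ {y = y} {C₁} {C₂} _ p q) =
      ∨c-least ⟦ C₁ ⟧-formal ⟦ C₂ ⟧-formal (conF-formal y) (sound p) (sound q)
    sound (□rule {y = y} {C} p q) =
      ≤-trans (sound p) (□c-mono ⟦ C ⟧-formal (conF-formal y) (sound q))
    sound (◇rule p q)            = ≤-trans (◇c-mono (sound q)) (sound p)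
    sound (adjR□₁ {y = y} p)     = from (L□c⊣□c (conF-formal y)) (sound p)
    sound (adjR□₂ {b = b} {y} p) = subst (conO b ≤_) (sym (conF-box y)) (sound p)
    sound (adjR◇₁ {b = b} {y} p) = subst (_≤ conF y) (sym (conO-dia b)) (sound p)
    sound (adjR◇₂ {y = y} p)     = to (◇c⊣■c (conF-formal y)) (sound p)
    sound (icR□₁ {b = b} {y} p)  = subst (conO b ≤_) (conF-box y) (sound p)
    sound (icR□₂ {y = y} p)      = to (L□c⊣□c (conF-formal y)) (sound p)
    sound (icR◇₁ {y = y} p)      = from (◇c⊣■c (conF-formal y)) (sound p)
    sound (icR◇₂ {b = b} {y} p)  = subst (_≤ conF y) (conO-dia b) (sound p)
    sound (negA _)               = tt
    sound (negX _)               = tt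
    sound (appA p)               = sound p
    sound (appX p)               = sound p

Entails : ABox → Atom Obj Feat → Set₁
Entails 𝒜 α = 𝒜 ⊨ (λ M → ConceptLattice.lhs M α) ⊑ (λ M → ConceptLattice.rhs M α)

sound-entails : ∀ {𝒜 α} → pos α ∈‾ 𝒜 → Entails 𝒜 α
sound-entails p M ⊨M = ≤⇒⊑ (sound ⊨M p)
  where open ConceptLattice M

module WellFormedNames (𝒜 : ABox) where

  data Occurs◇ : Concept → Set where
    occurs   : ∀ {C} → Occurs C 𝒜 → Occurs◇ C
    ◇-prefix : ∀ {C} → Occurs◇ C → Occurs◇ (◇ C)

  data Occurs□ : Concept → Set where
    occurs   : ∀ {C} → Occurs C 𝒜 → Occurs□ C
    □-prefix : ∀ {C} → Occurs□ C → Occurs□ (□ C)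

  -- Since ◇ a_C is a_{◇C}, the classifying objects of 𝒜‾ are the a_C with C occurring in 𝒜
  -- up to a prefix of ◇'s, and diaT is never applied to a classifying object (dually for
  -- features). The excluded name diaT (aC C) would not lie in its own companion ◇ C.
  WellFormedObj : Obj → Set
  WellFormedObj (oc n)          = ⊤
  WellFormedObj (aC C)          = Occurs◇ C
  WellFormedObj (diaT (aC C))   = ⊥
  WellFormedObj (diaT (oc n))   = ⊤
  WellFormedObj (diaT (diaT b)) = WellFormedObj (diaT b)
  WellFormedObj (diaT (lbox b)) = WellFormedObj (lbox b)
  WellFormedObj (lbox b)        = WellFormedObj b

  WellFormedFeat : Feat → Set
  WellFormedFeat (fc n)          = ⊤
  WellFormedFeat (xC C)          = Occurs□ C
  WellFormedFeat (boxT (xC C))   = ⊥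
  WellFormedFeat (boxT (fc n))   = ⊤
  WellFormedFeat (boxT (boxT y)) = WellFormedFeat (boxT y)
  WellFormedFeat (boxT (bsq y))  = WellFormedFeat (bsq y)
  WellFormedFeat (bsq y)         = WellFormedFeat y

  wf-dia : ∀ b → WellFormedObj b → WellFormedObj (dia b)
  wf-dia (oc n)   w = w
  wf-dia (aC C)   w = ◇-prefix w
  wf-dia (diaT b) w = w
  wf-dia (lbox b) w = w

  wf-dia⁻¹ : ∀ b → WellFormedObj (dia b) → WellFormedObj b
  wf-dia⁻¹ (oc n)   w            = w
  wf-dia⁻¹ (aC C)   (occurs o)   = occurs (Occurs-sub (◇s here) o)
  wf-dia⁻¹ (aC C)   (◇-prefix w) = w
  wf-dia⁻¹ (diaT b) w            = w
  wf-dia⁻¹ (lbox b) w            = w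

  wf-box : ∀ y → WellFormedFeat y → WellFormedFeat (box y)
  wf-box (fc n)   w = w
  wf-box (xC C)   w = □-prefix w
  wf-box (boxT y) w = w
  wf-box (bsq y)  w = w

  wf-box⁻¹ : ∀ y → WellFormedFeat (box y) → WellFormedFeat y
  wf-box⁻¹ (fc n)   w            = w
  wf-box⁻¹ (xC C)   (occurs o)   = occurs (Occurs-sub (□s here) o)
  wf-box⁻¹ (xC C)   (□-prefix w) = w
  wf-box⁻¹ (boxT y) w            = w
  wf-box⁻¹ (bsq y)  w            = w

  WellFormedAtom : Atom Obj Feat → Set
  WellFormedAtom (rbox b y) = WellFormedObj b × WellFormedFeat y
  WellFormedAtom (rdia y b) = WellFormedFeat y × WellFormedObj b
  WellFormedAtom (inc b y)  = WellFormedObj b × WellFormedFeat y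
  WellFormedAtom (ext b C)  = WellFormedObj b
  WellFormedAtom (int y C)  = WellFormedFeat y

  -- Negated memberships keep their concept occurring in 𝒜, so that the negative rules only
  -- introduce well-formed classifying names.
  ConceptOccurs : Atom Obj Feat → Set
  ConceptOccurs (ext b C) = Occurs C 𝒜
  ConceptOccurs (int y C) = Occurs C 𝒜
  ConceptOccurs _         = ⊤

  WellFormedLit : Lit Obj Feat → Set
  WellFormedLit (pos α) = WellFormedAtom α
  WellFormedLit (neg α) = WellFormedAtom α × ConceptOccurs α

  wf-emb : ∀ {t} → t ∈ 𝒜 → WellFormedLit (emb t)
  wf-emb {pos (rbox a x)} _    = tt , tt
  wf-emb {pos (rdia x a)} _    = tt , tt
  wf-emb {pos (inc a x)}  _    = tt , tt
  wf-emb {pos (ext a C)}  _    = tt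
  wf-emb {pos (int x C)}  _    = tt
  wf-emb {neg (rbox a x)} _    = (tt , tt) , tt
  wf-emb {neg (rdia x a)} _    = (tt , tt) , tt
  wf-emb {neg (inc a x)}  _    = (tt , tt) , tt
  wf-emb {neg (ext a C)}  t∈𝒜 = tt , Occurs-member t∈𝒜 (cneg cext)
  wf-emb {neg (int x C)}  t∈𝒜 = tt , Occurs-member t∈𝒜 (cneg cint)

  wf-derived : ∀ {t} → t ∈‾ 𝒜 → WellFormedLit t
  wf-derived (init t∈𝒜)            = wf-emb t∈𝒜
  wf-derived (createA o)           = occurs o
  wf-derived (createX o)           = occurs o
  wf-derived (basic p q)           = wf-derived p , wf-derived q
  wf-derived (⊓A₁ p)               = wf-derived p
  wf-derived (⊓A₂ p)               = wf-derived p
  wf-derived (⊓A⁻¹ _ p _)          = wf-derived p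
  wf-derived (⊔X₁ p)               = wf-derived p
  wf-derived (⊔X₂ p)               = wf-derived p
  wf-derived (⊔X⁻¹ _ p _)          = wf-derived p
  wf-derived (□rule p q)           = wf-derived p , wf-derived q
  wf-derived (◇rule p q)           = wf-derived p , wf-derived q
  wf-derived (adjR□₁ p)            = wf-derived p
  wf-derived (adjR□₂ {y = y} p)    = map₂ (wf-box y) (wf-derived p)
  wf-derived (adjR◇₁ {b = b} p)    = let wy , wb = wf-derived p in wf-dia b wb , wy
  wf-derived (adjR◇₂ p)            = swap (wf-derived p)
  wf-derived (icR□₁ {y = y} p)     = map₂ (wf-box⁻¹ y) (wf-derived p)
  wf-derived (icR□₂ p)             = wf-derived p
  wf-derived (icR◇₁ p)             = swap (wf-derived p)
  wf-derived (icR◇₂ {b = b} p)     = let wdb , wy = wf-derived p in wy , wf-dia⁻¹ b wdb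
  wf-derived (negA p)              = let wb , oC = wf-derived p in (wb , occurs oC) , tt
  wf-derived (negX p)              = let wy , oC = wf-derived p in (occurs oC , wy) , tt
  wf-derived (appA p)              = proj₁ (wf-derived p)
  wf-derived (appX p)              = proj₂ (wf-derived p)

  wf-ObjIn : ∀ {b α} → ObjIn b α → WellFormedAtom α → WellFormedObj b
  wf-ObjIn o-rbox = proj₁
  wf-ObjIn o-rdia = proj₂
  wf-ObjIn o-inc  = proj₁
  wf-ObjIn o-ext  = id

  wf-FeatIn : ∀ {y α} → FeatIn y α → WellFormedAtom α → WellFormedFeat y
  wf-FeatIn f-rbox = proj₂
  wf-FeatIn f-rdia = proj₁
  wf-FeatIn f-inc  = proj₂
  wf-FeatIn f-int  = id

  wf-ObjAppears : ∀ {b} → ObjAppears b 𝒜 → WellFormedObj b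
  wf-ObjAppears (α , inj₁ p , b∈α) = wf-ObjIn b∈α (wf-derived p)
  wf-ObjAppears (α , inj₂ p , b∈α) = wf-ObjIn b∈α (proj₁ (wf-derived p))

  wf-FeatAppears : ∀ {y} → FeatAppears y 𝒜 → WellFormedFeat y
  wf-FeatAppears (α , inj₁ p , y∈α) = wf-FeatIn y∈α (wf-derived p)
  wf-FeatAppears (α , inj₂ p , y∈α) = wf-FeatIn y∈α (proj₁ (wf-derived p))

module Canonical (𝒜 : ABox) where
  open WellFormedNames 𝒜

  Inc : Obj → Feat → Set
  Inc b y = pos (inc b y) ∈‾ 𝒜

  -- Taking the Galois closure of the features of a_{atom n} makes every atom a formal concept
  -- of K, whether it occurs in 𝒜 or not.
  atom-ext : ℕ → Obj → Set
  atom-ext n b = ∀ y → Inc (aC (atom n)) y → Inc b y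

  atom-int : ℕ → Feat → Set
  atom-int n y = ∀ b → atom-ext n b → Inc b y

  -- The names □y, L□b, ◇b and ■y witness I-compatibility, through the adjunction rules.
  K : Model
  K = record
    { A  = Obj
    ; X  = Feat
    ; I  = Inc
    ; R□ = λ b y → pos (rbox b y) ∈‾ 𝒜
    ; R◇ = λ y b → pos (rdia y b) ∈‾ 𝒜
    ; R□⁰-stable = λ y b h → icR□₁ (h (box y) (λ _ → adjR□₂))
    ; R□¹-stable = λ b y h → icR□₂ (h (lbox b) (λ _ → adjR□₁))
    ; R◇⁰-stable = λ b y h → icR◇₂ (h (dia b) (λ _ → adjR◇₁))
    ; R◇¹-stable = λ y b h → icR◇₁ (h (bsq y) (λ _ → adjR◇₂))
    ; extD = atom-ext
    ; intD = atom-int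
    ; extD-closed = λ n b → mk⇔ (λ h y q → h y (λ b′ e → e y q)) (λ e y h → h b e)
    ; intD-closed = λ n y → mk⇔ id id
    ; objC  = oc
    ; featC = fc
    }

  open Sem K
  open ConceptLattice K

  record Truth (C : Concept) : Set where
    field
      ex-truth  : ∀ b → ex ⟦ C ⟧ b ⇔ pos (ext b C) ∈‾ 𝒜
      in'-truth : ∀ y → in' ⟦ C ⟧ y ⇔ pos (int y C) ∈‾ 𝒜
  open Truth

  -- a_C is the least object and x_C the greatest feature with the respective membership,
  -- so either side of C in K determines the other.
  in'-truth-from-ex : ∀ {C E} → Occurs C 𝒜 → (∀ b → E b ⇔ pos (ext b C) ∈‾ 𝒜) →
                      ∀ y → (E ↑) y ⇔ pos (int y C) ∈‾ 𝒜
  in'-truth-from-ex o E⇔ y = mk⇔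
    (λ h → appX (h (aC _) (from (E⇔ _) (createA o))))
    (λ p b e → basic (to (E⇔ b) e) p)

  ex-truth-from-in' : ∀ {C Q} → Occurs C 𝒜 → (∀ y → Q y ⇔ pos (int y C) ∈‾ 𝒜) →
                      ∀ b → (Q ↓) b ⇔ pos (ext b C) ∈‾ 𝒜
  ex-truth-from-in' o Q⇔ b = mk⇔
    (λ h → appA (h (xC _) (from (Q⇔ _) (createX o))))
    (λ p y q → basic p (to (Q⇔ y) q))

  truth : ∀ C → Occurs C 𝒜 → Truth C
  truth (atom n) o = record { ex-truth = ex⇔ ; in'-truth = in'-truth-from-ex o ex⇔ }
    where
    ex⇔ : ∀ b → atom-ext n b ⇔ pos (ext b (atom n)) ∈‾ 𝒜
    ex⇔ = ex-truth-from-in' o (λ y → mk⇔ appX (basic (createA o)))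
  truth (C₁ ⊓ C₂) o = record { ex-truth = ex⇔ ; in'-truth = in'-truth-from-ex o ex⇔ }
    where
    T₁ = truth C₁ (Occurs-sub (⊓l here) o)
    T₂ = truth C₂ (Occurs-sub (⊓r here) o)
    ex⇔ : ∀ b → ex ⟦ C₁ ⊓ C₂ ⟧ b ⇔ pos (ext b (C₁ ⊓ C₂)) ∈‾ 𝒜
    ex⇔ b = mk⇔
      (λ (e₁ , e₂) → ⊓A⁻¹ o (to (ex-truth T₁ b) e₁) (to (ex-truth T₂ b) e₂))
      (λ p → from (ex-truth T₁ b) (⊓A₁ p) , from (ex-truth T₂ b) (⊓A₂ p))
  truth (C₁ ⊔ C₂) o = record { ex-truth = ex-truth-from-in' o in'⇔ ; in'-truth = in'⇔ }
    where
    T₁ = truth C₁ (Occurs-sub (⊔l here) o)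
    T₂ = truth C₂ (Occurs-sub (⊔r here) o)
    in'⇔ : ∀ y → in' ⟦ C₁ ⊔ C₂ ⟧ y ⇔ pos (int y (C₁ ⊔ C₂)) ∈‾ 𝒜
    in'⇔ y = mk⇔
      (λ (q₁ , q₂) → ⊔X⁻¹ o (to (in'-truth T₁ y) q₁) (to (in'-truth T₂ y) q₂))
      (λ p → from (in'-truth T₁ y) (⊔X₁ p) , from (in'-truth T₂ y) (⊔X₂ p))
  truth (◇ D) o = record { ex-truth = ex-truth-from-in' o in'⇔ ; in'-truth = in'⇔ }
    where
    oD = Occurs-sub (◇s here) o
    T = truth D oD
    in'⇔ : ∀ y → in' ⟦ ◇ D ⟧ y ⇔ pos (int y (◇ D)) ∈‾ 𝒜
    in'⇔ y = mk⇔
      (λ h → appX (adjR◇₁ (h (aC D) (from (ex-truth T (aC D)) (createA oD)))))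
      (λ p b e → ◇rule p (to (ex-truth T b) e))
  truth (□ D) o = record { ex-truth = ex⇔ ; in'-truth = in'-truth-from-ex o ex⇔ }
    where
    oD = Occurs-sub (□s here) o
    T = truth D oD
    ex⇔ : ∀ b → ex ⟦ □ D ⟧ b ⇔ pos (ext b (□ D)) ∈‾ 𝒜
    ex⇔ b = mk⇔
      (λ h → appA (adjR□₂ (h (xC D) (from (in'-truth T (xC D)) (createX oD)))))
      (λ p y q → □rule p (to (in'-truth T y) q))

  ◇-self : ∀ b → ex (conO b) b → ex (◇c (conO b)) (dia b)
  ◇-self b e x h = adjR◇₁ (h b e)

  L□-self : ∀ b → ex (conO b) b → ex (L□c (conO b)) (lbox b)
  L□-self b e x h = adjR□₁ (h b e)

  □-self : ∀ y → in' (conF y) y → in' (□c (conF y)) (box y)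
  □-self y q a h = adjR□₂ (h y q)

  ■-self : ∀ y → in' (conF y) y → in' (■c (conF y)) (bsq y)
  ■-self y q a h = adjR◇₂ (h y q)

  aC-self : ∀ {C} → Occurs◇ C → ex ⟦ C ⟧ (aC C)
  aC-self (occurs o)   = from (ex-truth (truth _ o) _) (createA o)
  aC-self (◇-prefix r) = ◇-self (aC _) (aC-self r)

  xC-self : ∀ {C} → Occurs□ C → in' ⟦ C ⟧ (xC C)
  xC-self (occurs o)   = from (in'-truth (truth _ o) _) (createX o)
  xC-self (□-prefix r) = □-self (xC _) (xC-self r)

  conO-self : ∀ b → WellFormedObj b → ex (conO b) b
  conO-self (oc n)          _ = λ x q → q
  conO-self (aC C)          r = aC-self r
  conO-self (diaT (aC C))   ()
  conO-self (diaT (oc n))   w = ◇-self (oc n) (conO-self (oc n) w)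
  conO-self (diaT (diaT b)) w = ◇-self (diaT b) (conO-self (diaT b) w)
  conO-self (diaT (lbox b)) w = ◇-self (lbox b) (conO-self (lbox b) w)
  conO-self (lbox b)        w = L□-self b (conO-self b w)

  conF-self : ∀ y → WellFormedFeat y → in' (conF y) y
  conF-self (fc n)          _ = λ a q → q
  conF-self (xC C)          r = xC-self r
  conF-self (boxT (xC C))   ()
  conF-self (boxT (fc n))   w = □-self (fc n) (conF-self (fc n) w)
  conF-self (boxT (boxT y)) w = □-self (boxT y) (conF-self (boxT y) w)
  conF-self (boxT (bsq y))  w = □-self (bsq y) (conF-self (bsq y) w)
  conF-self (bsq y)         w = ■-self y (conF-self y w)

  satA⇔derived : ∀ α → (∀ {C} → ConOf C α → Occurs C 𝒜) → satA α ⇔ pos (embA α) ∈‾ 𝒜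
  satA⇔derived (rbox a x) _   = mk⇔ id id
  satA⇔derived (rdia x a) _   = mk⇔ id id
  satA⇔derived (inc a x)  _   = mk⇔ id id
  satA⇔derived (ext a C)  occ = ex-truth (truth C (occ cext)) (oc a)
  satA⇔derived (int x C)  occ = in'-truth (truth C (occ cint)) (fc x)

  -- A negative term of 𝒜 holds in K because its positive version, were it derivable,
  -- would hold in the model of 𝒜 by soundness.
  K-satisfies : Consistent 𝒜 → Satisfies 𝒜
  K-satisfies _ (pos α) t∈𝒜 = from (satA⇔derived α (λ c → Occurs-member t∈𝒜 (cpos c))) (init t∈𝒜)
  K-satisfies (M₀ , ⊨𝒜) (neg α) t∈𝒜 holds =
    ⊨𝒜 (neg α) t∈𝒜 (to (M₀.Meaning-embA⇔satA α) (M₀.sound ⊨𝒜 derived))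
    where
    module M₀ = ConceptLattice M₀
    derived = to (satA⇔derived α (λ c → Occurs-member t∈𝒜 (cneg c))) holds

  module _ (consistent : Consistent 𝒜) where

    private
      ⊨K : Satisfies 𝒜
      ⊨K = K-satisfies consistent

    inc-complete : ∀ {b y} → WellFormedObj b → WellFormedFeat y →
                   Entails 𝒜 (inc b y) → pos (inc b y) ∈‾ 𝒜
    inc-complete {b} {y} wb wy h =
      incident (conF-formal y) (h K ⊨K b (conO-self b wb)) (conF-self y wy)

    rbox-complete : ∀ {b y} → WellFormedObj b → WellFormedFeat y →
                    Entails 𝒜 (rbox b y) → pos (rbox b y) ∈‾ 𝒜
    rbox-complete {b} {y} wb wy h = h K ⊨K b (conO-self b wb) y (conF-self y wy)

    rdia-complete : ∀ {b y} → WellFormedFeat y → WellFormedObj b →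
                    Entails 𝒜 (rdia y b) → pos (rdia y b) ∈‾ 𝒜
    rdia-complete {b} {y} wy wb h =
      ≤⇒in'-⊇ (◇c-formal (conO b)) (conF-formal y) (⊑⇒≤ (h K ⊨K)) (conF-self y wy)
        b (conO-self b wb)

    ext-complete : ∀ {b C} → WellFormedObj b → Occurs C 𝒜 →
                   Entails 𝒜 (ext b C) → pos (ext b C) ∈‾ 𝒜
    ext-complete {b} {C} wb o h = to (ex-truth (truth C o) b) (h K ⊨K b (conO-self b wb))

    int-complete : ∀ {y C} → WellFormedFeat y → Occurs C 𝒜 →
                   Entails 𝒜 (int y C) → pos (int y C) ∈‾ 𝒜
    int-complete {y} {C} wy o h = to (in'-truth (truth C o) y)
      (≤⇒in'-⊇ ⟦ C ⟧-formal (conF-formal y) (⊑⇒≤ (h K ⊨K)) (conF-self y wy))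

open Sem using (conO; conF; ⟦_⟧; ◇c; □c)

lemma1 : ∀ (𝒜 : ABox) → Consistent 𝒜 →
    ∀ (b : Obj) (y : Feat) (C C₁ C₂ : Concept) →
    ObjAppears b 𝒜 → FeatAppears y 𝒜 →
    Occurs C 𝒜 → Occurs C₁ 𝒜 → Occurs C₂ 𝒜 →
    ((𝒜 ⊨ (λ M → conO M b) ⊑ (λ M → conF M y)) ⇔ (pos (inc b y) ∈‾ 𝒜))
    × ((𝒜 ⊨ (λ M → conO M b) ⊑ (λ M → □c M (conF M y))) ⇔ (pos (rbox b y) ∈‾ 𝒜))
    × ((𝒜 ⊨ (λ M → ◇c M (conO M b)) ⊑ (λ M → conF M y)) ⇔ (pos (rdia y b) ∈‾ 𝒜))
    × ((𝒜 ⊨ (λ M → conO M b) ⊑ (λ M → ⟦_⟧ M C)) ⇔ (pos (inc b (xC C)) ∈‾ 𝒜))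
    × ((𝒜 ⊨ (λ M → ⟦_⟧ M C) ⊑ (λ M → conF M y)) ⇔ (pos (inc (aC C) y) ∈‾ 𝒜))
    × ((𝒜 ⊨ (λ M → conO M b) ⊑ (λ M → ⟦_⟧ M C)) ⇔ (pos (ext b C) ∈‾ 𝒜))
    × ((𝒜 ⊨ (λ M → ⟦_⟧ M C) ⊑ (λ M → conF M y)) ⇔ (pos (int y C) ∈‾ 𝒜))
    × ((𝒜 ⊨ (λ M → ⟦_⟧ M C₁) ⊑ (λ M → ⟦_⟧ M C₂)) ⇔ (pos (inc (aC C₁) (xC C₂)) ∈‾ 𝒜))
lemma1 𝒜 consistent b y C C₁ C₂ b∈𝒜‾ y∈𝒜‾ oC oC₁ oC₂ =
    mk⇔ (inc-complete consistent wb wy) sound-entails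
  , mk⇔ (rbox-complete consistent wb wy) sound-entails
  , mk⇔ (rdia-complete consistent wy wb) sound-entails
  , mk⇔ (inc-complete consistent wb (occurs oC)) sound-entails
  , mk⇔ (inc-complete consistent (occurs oC) wy) sound-entails
  , mk⇔ (ext-complete consistent wb oC) sound-entails
  , mk⇔ (int-complete consistent wy oC) sound-entails
  , mk⇔ (inc-complete consistent (occurs oC₁) (occurs oC₂)) sound-entails
  where
  open WellFormedNames 𝒜
  open Canonical 𝒜
  wb = wf-ObjAppears b∈𝒜‾
  wy = wf-FeatAppears y∈𝒜‾
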